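{- Let $I$ be a perfect matching of $K_{42}$. Then the edge set of $K_{42}-I$ can be decomposed into $5$-star factors.
   Context: A $5$-star is a copy of $K_{1,5}$. A $5$-star factor of a graph $H$ is a spanning subgraph of $H$ each of whose components is a $5$-star; a decomposition into $5$-star factors is a collection of such factors whose edge sets partition the edge set of $H$. -}

module Defs where

open import Level using (0ℓ)
open import Data.Nat using (ℕ; suc)
open import Data.Fin using (Fin; zero; suc)
open import Data.Product using (Σ; ∃; ∃-syntax; ∃!; _×_; _,_)
open import Data.Sum using (_⊎_)
open import Relation.Nullary using (¬_)
open import Relation.Binary.PropositionalEquality using (_≡_; _≢_) renaming (sym to ≡-sym; refl to ≡-refl)
open import Function.Definitions using (Bijective)

record Graph (n : ℕ) : Set₁ where
  field
    Adj    : Fin n → Fin n → Set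
    Adj-sym    : ∀ {u v} → Adj u v → Adj v u
    Adj-irrefl : ∀ {u} → ¬ Adj u u
open Graph public

record PerfectMatching (n : ℕ) : Set₁ where
  field
    M       : Fin n → Fin n → Set
    M-sym   : ∀ {u v} → M u v → M v u
    M-irref : ∀ {u} → ¬ M u u
    M-cover : ∀ u → ∃! _≡_ (λ v → M u v)
open PerfectMatching public

KminusPM : (n : ℕ) → PerfectMatching n → Graph n
KminusPM n I = record
  { Adj    = λ u v → (u ≢ v) × ¬ M I u v
  ; Adj-sym    = λ { (u≢v , ¬m) → (λ e → u≢v (≡-sym e)) , (λ m → ¬m (M-sym I m)) }
  ; Adj-irrefl = λ { (u≢u , _) → u≢u ≡-refl }
  }

-- A k-star factor of a graph H on Fin n: a spanning subgraph of H every
-- component of which is a copy of K_{1,k}.  It is given by m stars and a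
-- bijection  vertex : Fin m × Fin (suc k) → Fin n  (so the stars are vertex
-- disjoint and cover all vertices); star i has centre  vertex (i , zero)
-- and leaves  vertex (i , suc j) , j : Fin k.
record StarFactor (k : ℕ) {n : ℕ} (H : Graph n) : Set where
  field
    m        : ℕ
    vertex   : Fin m × Fin (suc k) → Fin n
    vertex-bij : Bijective _≡_ _≡_ vertex
  Edge : Fin n → Fin n → Set
  Edge u v = ∃[ i ] ∃[ j ]
      ((u ≡ vertex (i , zero) × v ≡ vertex (i , suc j))
     ⊎ (v ≡ vertex (i , zero) × u ≡ vertex (i , suc j)))
  field
    edges-in-H : ∀ {u v} → Edge u v → Adj H u v
open StarFactor public

StarFactorDecomposition : (k : ℕ) {n : ℕ} (H : Graph n) → Set
StarFactorDecomposition k {n} H =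
  Σ ℕ λ t → Σ (Fin t → StarFactor k H) λ F →
    ∀ u v → Adj H u v → ∃! _≡_ (λ (i : Fin t) → Edge (F i) u v)

{-# OPTIONS --safe #-}
module Submission where

-- K₄₂ − I depends on I only up to relabelling: every fixed-point-free involution p of
-- Fin (h + h) is conjugate to the standard one x ↔ x + h, by a product of h transpositions,
-- each sending one more standard pair onto a pair of p without disturbing the earlier ones.
-- Graph isomorphisms transport star-factor decompositions, so it suffices to decompose
-- K₄₂ minus the matching x ↔ x + 21. There, four base 5-star factors on ℤ₄₂, each translated
-- by 7r for r < 6, give 24 factors with 24 · 35 = 840 = 42 · 40 / 2 edges. This is verified by
-- evaluation: every factor comes with the inverse of its vertex map, and a table sending each
-- edge to its (factor, star, leaf) slot is inverse to the slot enumeration, so the cover is exact.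

open import Defs
import Data.Nat as ℕ
open import Data.Nat using (ℕ; zero; suc; _+_; _*_; _∸_; _/_; _<_; _≤_; s≤s⁻¹)
open import Data.Nat.Properties using (≤-refl; <⇒≤; ≤∧≢⇒<)
open import Data.Nat.DivMod using (_mod_)
open import Data.Fin using (Fin; zero; suc; toℕ; fromℕ<; splitAt; remQuot; _↑ˡ_; _↑ʳ_)
open import Data.Fin.Properties using (_≟_; all?; toℕ<n; splitAt-↑ˡ; splitAt-↑ʳ; splitAt⁻¹-↑ˡ; splitAt⁻¹-↑ʳ;
  ↑ˡ-injective; ↑ʳ-injective; toℕ-injective; toℕ-fromℕ<)
import Data.Fin.Permutation.Components as PC
open import Data.Fin.Permutation using (Permutation′; _⟨$⟩ʳ_; _⟨$⟩ˡ_; _∘ₚ_; transpose; inverseˡ; inverseʳ)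
import Data.Fin.Permutation as Perm
open import Data.Product using (∃-syntax; _×_; _,_; proj₁; proj₂)
import Data.Product as Σ
open import Data.Product.Properties using (≡-dec)
open import Data.Sum using (_⊎_; inj₁; inj₂; [_,_]′)
import Data.Sum as Sum
open import Data.Unit using (tt)
open import Data.Vec using (Vec; lookup; _∷_; [])
open import Function using (_∘_; _↔_; Inverse; mk↔ₛ′)
open import Function.Properties.Inverse using (↔⇒⤖)
open import Function.Bundles using (Bijection)
import Function.Construct.Composition as Comp
open import Relation.Nullary using (Dec; yes; no)
open import Relation.Nullary.Decidable using (toWitness; dec-true; dec-false; ¬?; _×-dec_; _⊎-dec_; _→-dec_)
open import Relation.Binary.Definitions using (DecidableEquality)
open import Relation.Binary.PropositionalEquality
  using (_≡_; _≢_; refl; sym; trans; cong; subst; subst₂; module ≡-Reasoning)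

private
  variable
    n h : ℕ

module _ (I : PerfectMatching n) where

  partner : Fin n → Fin n
  partner u = proj₁ (M-cover I u)

  partner-matched : ∀ u → M I u (partner u)
  partner-matched u = proj₁ (proj₂ (M-cover I u))

  partner-unique : ∀ {u v} → M I u v → partner u ≡ v
  partner-unique {u} = proj₂ (proj₂ (M-cover I u))

  partner-involutive : ∀ u → partner (partner u) ≡ u
  partner-involutive u = partner-unique (M-sym I (partner-matched u))

  partner-fixedPointFree : ∀ u → partner u ≢ u
  partner-fixedPointFree u eq = M-irref I (subst (M I u) eq (partner-matched u))

↑ˡ≢↑ʳ : ∀ (i : Fin h) (j : Fin n) → i ↑ˡ n ≢ h ↑ʳ j
↑ˡ≢↑ʳ {h} {n} i j eq
  with () ← trans (sym (splitAt-↑ˡ h i n)) (trans (cong (splitAt h) eq) (splitAt-↑ʳ h n j))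

↑ˡ-or-↑ʳ : ∀ (x : Fin (h + n)) → (∃[ i ] i ↑ˡ n ≡ x) ⊎ (∃[ j ] h ↑ʳ j ≡ x)
↑ˡ-or-↑ʳ {h} x with splitAt h x in eq
... | inj₁ i = inj₁ (i , splitAt⁻¹-↑ˡ eq)
... | inj₂ j = inj₂ (j , splitAt⁻¹-↑ʳ eq)

standardPartner : ∀ h → Fin (h + h) → Fin (h + h)
standardPartner h x = [ h ↑ʳ_ , _↑ˡ h ]′ (splitAt h x)

standardPartner-↑ˡ : ∀ (i : Fin h) → standardPartner h (i ↑ˡ h) ≡ h ↑ʳ i
standardPartner-↑ˡ {h} i rewrite splitAt-↑ˡ h i h = refl

standardPartner-↑ʳ : ∀ (j : Fin h) → standardPartner h (h ↑ʳ j) ≡ j ↑ˡ h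
standardPartner-↑ʳ {h} j rewrite splitAt-↑ʳ h h j = refl

standardPartner-involutive : ∀ x → standardPartner h (standardPartner h x) ≡ x
standardPartner-involutive {h} x with ↑ˡ-or-↑ʳ {h} x
... | inj₁ (i , refl) rewrite standardPartner-↑ˡ i = standardPartner-↑ʳ i
... | inj₂ (j , refl) rewrite standardPartner-↑ʳ j = standardPartner-↑ˡ j

standardPartner-fixedPointFree : ∀ x → standardPartner h x ≢ x
standardPartner-fixedPointFree {h} x with ↑ˡ-or-↑ʳ {h} x
... | inj₁ (i , refl) = λ eq → ↑ˡ≢↑ʳ i i (sym (trans (sym (standardPartner-↑ˡ i)) eq))
... | inj₂ (j , refl) = λ eq → ↑ˡ≢↑ʳ j j (trans (sym (standardPartner-↑ʳ j)) eq)

standardMatching : ∀ h → PerfectMatching (h + h)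
standardMatching h = record
  { M       = λ u v → standardPartner h u ≡ v
  ; M-sym   = λ { refl → standardPartner-involutive {h} _ }
  ; M-irref = standardPartner-fixedPointFree {h} _
  ; M-cover = λ u → standardPartner h u , refl , λ eq → eq
  }

transpose-matchˡ : ∀ (i j : Fin n) → PC.transpose i j i ≡ j
transpose-matchˡ i j rewrite dec-true (i ≟ i) refl = refl

transpose-matchʳ : ∀ (i j : Fin n) → PC.transpose i j j ≡ i
transpose-matchʳ i j with j ≟ i
... | yes j≡i = j≡i
... | no _ rewrite dec-true (j ≟ j) refl = refl

transpose-fixes : ∀ {i j x : Fin n} → x ≢ i → x ≢ j → PC.transpose i j x ≡ x
transpose-fixes {i = i} {j} {x} x≢i x≢j rewrite dec-false (x ≟ i) x≢i | dec-false (x ≟ j) x≢j = refl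

module Conjugation {h : ℕ} (p : Fin (h + h) → Fin (h + h))
  (p-involutive : ∀ x → p (p x) ≡ x) (p-fixedPointFree : ∀ x → p x ≢ x) where

  p-injective : ∀ {x y} → p x ≡ p y → x ≡ y
  p-injective {x} {y} eq = trans (sym (p-involutive x)) (trans (cong p eq) (p-involutive y))

  Aligned : Permutation′ (h + h) → Fin h → Set
  Aligned π j = p (π ⟨$⟩ʳ (j ↑ˡ h)) ≡ π ⟨$⟩ʳ (h ↑ʳ j)

  align : Permutation′ (h + h) → Fin h → Permutation′ (h + h)
  align π k = π ∘ₚ transpose (π ⟨$⟩ʳ (h ↑ʳ k)) (p (π ⟨$⟩ʳ (k ↑ˡ h)))

  module _ (π : Permutation′ (h + h)) where
    private
      π-injective : ∀ {x y} → π ⟨$⟩ʳ x ≡ π ⟨$⟩ʳ y → x ≡ y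
      π-injective = Bijection.injective (↔⇒⤖ π)

    align-aligns : ∀ k → Aligned (align π k) k
    align-aligns k = begin
      p (PC.transpose c b a) ≡⟨ cong p (transpose-fixes a≢c a≢b) ⟩
      b                      ≡⟨ transpose-matchˡ c b ⟨
      PC.transpose c b c     ∎
      where
      open ≡-Reasoning
      a = π ⟨$⟩ʳ (k ↑ˡ h)
      c = π ⟨$⟩ʳ (h ↑ʳ k)
      b = p a
      a≢c : a ≢ c
      a≢c = ↑ˡ≢↑ʳ k k ∘ π-injective
      a≢b : a ≢ b
      a≢b = p-fixedPointFree a ∘ sym

    align-preserves : ∀ {j k} → j ≢ k → Aligned π j → Aligned (align π k) j
    align-preserves {j} {k} j≢k aligned = begin
      p (PC.transpose c b x) ≡⟨ cong p (transpose-fixes x≢c x≢b) ⟩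
      p x                    ≡⟨ aligned ⟩
      y                      ≡⟨ transpose-fixes y≢c y≢b ⟨
      PC.transpose c b y     ∎
      where
      open ≡-Reasoning
      a = π ⟨$⟩ʳ (k ↑ˡ h)
      c = π ⟨$⟩ʳ (h ↑ʳ k)
      b = p a
      x = π ⟨$⟩ʳ (j ↑ˡ h)
      y = π ⟨$⟩ʳ (h ↑ʳ j)
      x≢c : x ≢ c
      x≢c = ↑ˡ≢↑ʳ j k ∘ π-injective
      x≢b : x ≢ b
      x≢b x≡b = ↑ˡ≢↑ʳ k j (π-injective (trans (sym (p-involutive a)) (trans (cong p (sym x≡b)) aligned)))
      y≢c : y ≢ c
      y≢c = j≢k ∘ ↑ʳ-injective h j k ∘ π-injective
      y≢b : y ≢ b
      y≢b y≡b = j≢k (↑ˡ-injective h j k (π-injective (p-injective (trans aligned y≡b))))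

  -- Opaque: unfolding the nested transpositions during conversion checking is exponential.
  opaque
    alignBelow : ∀ n → n ≤ h → ∃[ π ] ∀ j → toℕ j < n → Aligned π j
    alignBelow zero    _   = Perm.id , λ _ ()
    alignBelow (suc n) n<h with π , aligned ← alignBelow n (<⇒≤ n<h) = align π k , aligned′
      where
      k : Fin h
      k = fromℕ< n<h
      aligned′ : ∀ j → toℕ j < suc n → Aligned (align π k) j
      aligned′ j j<1+n with toℕ j ℕ.≟ n
      ... | yes j≡n = subst (Aligned (align π k))
                            (toℕ-injective (trans (toℕ-fromℕ< n<h) (sym j≡n))) (align-aligns π k)
      ... | no  j≢n = align-preserves π (λ j≡k → j≢n (trans (cong toℕ j≡k) (toℕ-fromℕ< n<h)))
                                        (aligned j (≤∧≢⇒< (s≤s⁻¹ j<1+n) j≢n))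

  conjugator : ∃[ σ ] ∀ x → p (σ ⟨$⟩ʳ x) ≡ σ ⟨$⟩ʳ standardPartner h x
  conjugator with σ , aligned ← alignBelow h ≤-refl = σ , conjugates
    where
    open ≡-Reasoning
    conjugates : ∀ x → p (σ ⟨$⟩ʳ x) ≡ σ ⟨$⟩ʳ standardPartner h x
    conjugates x with ↑ˡ-or-↑ʳ {h} x
    ... | inj₁ (j , refl) = begin
      p (σ ⟨$⟩ʳ (j ↑ˡ h))                  ≡⟨ aligned j (toℕ<n j) ⟩
      σ ⟨$⟩ʳ (h ↑ʳ j)                      ≡⟨ cong (σ ⟨$⟩ʳ_) (standardPartner-↑ˡ j) ⟨
      σ ⟨$⟩ʳ standardPartner h (j ↑ˡ h)    ∎
    ... | inj₂ (j , refl) = begin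
      p (σ ⟨$⟩ʳ (h ↑ʳ j))                  ≡⟨ cong p (aligned j (toℕ<n j)) ⟨
      p (p (σ ⟨$⟩ʳ (j ↑ˡ h)))              ≡⟨ p-involutive _ ⟩
      σ ⟨$⟩ʳ (j ↑ˡ h)                      ≡⟨ cong (σ ⟨$⟩ʳ_) (standardPartner-↑ʳ j) ⟨
      σ ⟨$⟩ʳ standardPartner h (h ↑ʳ j)    ∎

record _≅_ (G H : Graph n) : Set where
  field
    φ       : Permutation′ n
    φ-adj   : ∀ {u v} → Adj G u v → Adj H (φ ⟨$⟩ʳ u) (φ ⟨$⟩ʳ v)
    φ⁻¹-adj : ∀ {u v} → Adj H u v → Adj G (φ ⟨$⟩ˡ u) (φ ⟨$⟩ˡ v)

complement-≅ : (J I : PerfectMatching n) (σ : Permutation′ n) →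
               (∀ x → partner I (σ ⟨$⟩ʳ x) ≡ σ ⟨$⟩ʳ partner J x) →
               KminusPM n J ≅ KminusPM n I
complement-≅ {n} J I σ conjugates = record
  { φ       = σ
  ; φ-adj   = λ (u≢v , ¬Juv) → u≢v ∘ σ-injective , ¬Juv ∘ M-reflected
  ; φ⁻¹-adj = λ (u≢v , ¬Iuv) →
      u≢v ∘ σ⁻¹-injective , ¬Iuv ∘ subst₂ (M I) (inverseʳ σ) (inverseʳ σ) ∘ M-preserved
  }
  where
  σ-injective : ∀ {u v} → σ ⟨$⟩ʳ u ≡ σ ⟨$⟩ʳ v → u ≡ v
  σ-injective = Bijection.injective (↔⇒⤖ σ)
  σ⁻¹-injective : ∀ {u v} → σ ⟨$⟩ˡ u ≡ σ ⟨$⟩ˡ v → u ≡ v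
  σ⁻¹-injective = Bijection.injective (↔⇒⤖ (Perm.flip σ))
  M-reflected : ∀ {u v} → M I (σ ⟨$⟩ʳ u) (σ ⟨$⟩ʳ v) → M J u v
  M-reflected {u} m = subst (M J u) (σ-injective (trans (sym (conjugates u)) (partner-unique I m)))
                        (partner-matched J u)
  M-preserved : ∀ {u v} → M J u v → M I (σ ⟨$⟩ʳ u) (σ ⟨$⟩ʳ v)
  M-preserved {u} m = subst (M I _) (trans (conjugates u) (cong (σ ⟨$⟩ʳ_) (partner-unique J m)))
                        (partner-matched I (σ ⟨$⟩ʳ u))

module _ {k : ℕ} {G H : Graph n} (G≅H : G ≅ H) where
  open _≅_ G≅H

  transportFactor : StarFactor k G → StarFactor k H
  transportFactor F = record
    { m          = m F
    ; vertex     = (φ ⟨$⟩ʳ_) ∘ vertex F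
    ; vertex-bij = Comp.bijective _≡_ _≡_ _≡_ (vertex-bij F) (Bijection.bijective (↔⇒⤖ φ))
    ; edges-in-H = λ where
        (i , j , inj₁ (refl , refl)) → φ-adj (edges-in-H F (i , j , inj₁ (refl , refl)))
        (i , j , inj₂ (refl , refl)) → φ-adj (edges-in-H F (i , j , inj₂ (refl , refl)))
    }

  Edge-transport : ∀ F {u v} → Edge F (φ ⟨$⟩ˡ u) (φ ⟨$⟩ˡ v) → Edge (transportFactor F) u v
  Edge-transport F = Σ.map₂ (Σ.map₂ (Sum.map (Σ.map moved moved) (Σ.map moved moved)))
    where
    moved : ∀ {u x} → φ ⟨$⟩ˡ u ≡ x → u ≡ φ ⟨$⟩ʳ x
    moved eq = trans (sym (inverseʳ φ)) (cong (φ ⟨$⟩ʳ_) eq)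

  Edge-transport⁻¹ : ∀ F {u v} → Edge (transportFactor F) u v → Edge F (φ ⟨$⟩ˡ u) (φ ⟨$⟩ˡ v)
  Edge-transport⁻¹ F = Σ.map₂ (Σ.map₂ (Sum.map (Σ.map moved moved) (Σ.map moved moved)))
    where
    moved : ∀ {u x} → u ≡ φ ⟨$⟩ʳ x → φ ⟨$⟩ˡ u ≡ x
    moved eq = trans (cong (φ ⟨$⟩ˡ_) eq) (inverseˡ φ)

  transportDecomposition : StarFactorDecomposition k G → StarFactorDecomposition k H
  transportDecomposition (t , F , unique) = t , transportFactor ∘ F , λ u v adj →
    let i , edge , only = unique _ _ (φ⁻¹-adj adj)
    in  i , Edge-transport (F i) edge , λ {i′} edge′ → only (Edge-transport⁻¹ (F i′) edge′)

-- The slot (f , i , j) is the edge joining the centre of star i of factor f to its j-th leaf.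
Slot : (factors stars k : ℕ) → Set
Slot factors stars k = Fin factors × Fin stars × Fin k

_≟-slot_ : ∀ {factors stars k} → DecidableEquality (Slot factors stars k)
_≟-slot_ = ≡-dec _≟_ (≡-dec _≟_ _≟_)

module _ {factors stars k : ℕ} (layout : Fin factors → (Fin stars × Fin (suc k)) ↔ Fin n) where

  centre : Slot factors stars k → Fin n
  centre (f , i , _) = Inverse.to (layout f) (i , zero)

  leaf : Slot factors stars k → Fin n
  leaf (f , i , j) = Inverse.to (layout f) (i , suc j)

  Joins : Slot factors stars k → Fin n → Fin n → Set
  Joins e u v = (u ≡ centre e × v ≡ leaf e) ⊎ (v ≡ centre e × u ≡ leaf e)

  joins? : ∀ e u v → Dec (Joins e u v)
  joins? e u v = (u ≟ centre e ×-dec v ≟ leaf e) ⊎-dec (v ≟ centre e ×-dec u ≟ leaf e)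

record StarFactorTable (k : ℕ) (H : Graph n) : Set where
  field
    factors stars     : ℕ
    layout            : Fin factors → (Fin stars × Fin (suc k)) ↔ Fin n
    slot-adj          : ∀ e → Adj H (centre layout e) (leaf layout e)
    slotOf            : Fin n → Fin n → Slot factors stars k
    slotOf-centreLeaf : ∀ e → slotOf (centre layout e) (leaf layout e) ≡ e
    slotOf-leafCentre : ∀ e → slotOf (leaf layout e) (centre layout e) ≡ e
    slotOf-joins      : ∀ {u v} → Adj H u v → Joins layout (slotOf u v) u v

  slotOf-unique : ∀ {e u v} → Joins layout e u v → slotOf u v ≡ e
  slotOf-unique {e} (inj₁ (refl , refl)) = slotOf-centreLeaf e
  slotOf-unique {e} (inj₂ (refl , refl)) = slotOf-leafCentre e

  factor : Fin factors → StarFactor k H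
  factor f = record
    { m          = stars
    ; vertex     = Inverse.to (layout f)
    ; vertex-bij = Bijection.bijective (↔⇒⤖ (layout f))
    ; edges-in-H = λ where
        (i , j , inj₁ (refl , refl)) → slot-adj (f , i , j)
        (i , j , inj₂ (refl , refl)) → Adj-sym H (slot-adj (f , i , j))
    }

  decomposition : StarFactorDecomposition k H
  decomposition = factors , factor , λ u v adj →
    let f , i , j = slotOf u v
    in  f , (i , j , slotOf-joins adj) , λ (_ , _ , joins) → cong proj₁ (slotOf-unique joins)

module K₄₂ where

  -- Vertices are residues mod 42, and the standard matching pairs x with x + 21. Factor 6b + r
  -- is base factor b translated by 7r; each row of a base factor is a star, centre first.
  -- Positions (i , j) and slots (f , i , j) are stored as the codes 6i + j and 35f + 5i + j;
  -- the entries of slotCodes at non-edges (u = v or a matching pair) are unused.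

  baseFactors : Vec (Vec (Vec ℕ 6) 7) 4
  baseFactors =
    ( (16 ∷ 9 ∷ 6 ∷ 13 ∷ 11 ∷ 36 ∷ [])
      ∷ (14 ∷ 15 ∷ 22 ∷ 17 ∷ 0 ∷ 38 ∷ [])
      ∷ (28 ∷ 23 ∷ 27 ∷ 32 ∷ 25 ∷ 20 ∷ [])
      ∷ (10 ∷ 4 ∷ 5 ∷ 19 ∷ 29 ∷ 24 ∷ [])
      ∷ (18 ∷ 30 ∷ 8 ∷ 40 ∷ 7 ∷ 37 ∷ [])
      ∷ (2 ∷ 31 ∷ 35 ∷ 21 ∷ 33 ∷ 1 ∷ [])
      ∷ (34 ∷ 41 ∷ 39 ∷ 3 ∷ 12 ∷ 26 ∷ [])
      ∷ [])
    ∷ ( (11 ∷ 29 ∷ 34 ∷ 9 ∷ 20 ∷ 35 ∷ [])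
      ∷ (33 ∷ 25 ∷ 0 ∷ 10 ∷ 30 ∷ 23 ∷ [])
      ∷ (37 ∷ 1 ∷ 6 ∷ 7 ∷ 13 ∷ 8 ∷ [])
      ∷ (31 ∷ 38 ∷ 16 ∷ 21 ∷ 36 ∷ 18 ∷ [])
      ∷ (24 ∷ 2 ∷ 27 ∷ 4 ∷ 32 ∷ 40 ∷ [])
      ∷ (41 ∷ 17 ∷ 3 ∷ 5 ∷ 26 ∷ 14 ∷ [])
      ∷ (22 ∷ 39 ∷ 12 ∷ 15 ∷ 19 ∷ 28 ∷ [])
      ∷ [])
    ∷ ( (34 ∷ 15 ∷ 21 ∷ 24 ∷ 22 ∷ 28 ∷ [])
      ∷ (4 ∷ 30 ∷ 3 ∷ 14 ∷ 37 ∷ 8 ∷ [])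
      ∷ (9 ∷ 10 ∷ 1 ∷ 7 ∷ 13 ∷ 23 ∷ [])
      ∷ (18 ∷ 11 ∷ 6 ∷ 5 ∷ 33 ∷ 32 ∷ [])
      ∷ (40 ∷ 39 ∷ 2 ∷ 41 ∷ 29 ∷ 27 ∷ [])
      ∷ (0 ∷ 20 ∷ 38 ∷ 31 ∷ 12 ∷ 16 ∷ [])
      ∷ (19 ∷ 26 ∷ 17 ∷ 25 ∷ 36 ∷ 35 ∷ [])
      ∷ [])
    ∷ ( (24 ∷ 30 ∷ 39 ∷ 16 ∷ 12 ∷ 8 ∷ [])
      ∷ (22 ∷ 11 ∷ 36 ∷ 25 ∷ 13 ∷ 37 ∷ [])
      ∷ (6 ∷ 23 ∷ 32 ∷ 31 ∷ 20 ∷ 4 ∷ [])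
      ∷ (1 ∷ 27 ∷ 19 ∷ 5 ∷ 3 ∷ 41 ∷ [])
      ∷ (29 ∷ 0 ∷ 38 ∷ 34 ∷ 17 ∷ 14 ∷ [])
      ∷ (26 ∷ 40 ∷ 2 ∷ 9 ∷ 21 ∷ 7 ∷ [])
      ∷ (35 ∷ 33 ∷ 10 ∷ 28 ∷ 15 ∷ 18 ∷ [])
      ∷ [])
    ∷ []

  basePositions : Vec (Vec ℕ 42) 4
  basePositions =
    (10 ∷ 35 ∷ 30 ∷ 39 ∷ 19 ∷ 20 ∷ 2 ∷ 28 ∷ 26 ∷ 1 ∷ 18 ∷ 4 ∷ 40 ∷ 3 ∷ 6 ∷ 7 ∷ 0 ∷ 9 ∷ 24 ∷ 21 ∷ 17 ∷ 33 ∷ 8 ∷ 13 ∷ 23 ∷ 16 ∷ 41 ∷ 14 ∷ 12 ∷ 22 ∷ 25 ∷ 31 ∷ 15 ∷ 34 ∷ 36 ∷ 32 ∷ 5 ∷ 29 ∷ 11 ∷ 38 ∷ 27 ∷ 37 ∷ [])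
    ∷ (8 ∷ 13 ∷ 25 ∷ 32 ∷ 27 ∷ 33 ∷ 14 ∷ 15 ∷ 17 ∷ 3 ∷ 9 ∷ 0 ∷ 38 ∷ 16 ∷ 35 ∷ 39 ∷ 20 ∷ 31 ∷ 23 ∷ 40 ∷ 4 ∷ 21 ∷ 36 ∷ 11 ∷ 24 ∷ 7 ∷ 34 ∷ 26 ∷ 41 ∷ 1 ∷ 10 ∷ 18 ∷ 28 ∷ 6 ∷ 2 ∷ 5 ∷ 22 ∷ 12 ∷ 19 ∷ 37 ∷ 29 ∷ 30 ∷ [])
    ∷ (30 ∷ 14 ∷ 26 ∷ 8 ∷ 6 ∷ 21 ∷ 20 ∷ 15 ∷ 11 ∷ 12 ∷ 13 ∷ 19 ∷ 34 ∷ 16 ∷ 9 ∷ 1 ∷ 35 ∷ 38 ∷ 18 ∷ 36 ∷ 31 ∷ 2 ∷ 4 ∷ 17 ∷ 3 ∷ 39 ∷ 37 ∷ 29 ∷ 5 ∷ 28 ∷ 7 ∷ 33 ∷ 23 ∷ 22 ∷ 0 ∷ 41 ∷ 40 ∷ 10 ∷ 32 ∷ 25 ∷ 24 ∷ 27 ∷ [])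
    ∷ (25 ∷ 18 ∷ 32 ∷ 22 ∷ 17 ∷ 21 ∷ 12 ∷ 35 ∷ 5 ∷ 33 ∷ 38 ∷ 7 ∷ 4 ∷ 10 ∷ 29 ∷ 40 ∷ 3 ∷ 28 ∷ 41 ∷ 20 ∷ 16 ∷ 34 ∷ 6 ∷ 13 ∷ 0 ∷ 9 ∷ 30 ∷ 19 ∷ 39 ∷ 24 ∷ 1 ∷ 15 ∷ 14 ∷ 37 ∷ 27 ∷ 36 ∷ 8 ∷ 11 ∷ 26 ∷ 2 ∷ 31 ∷ 23 ∷ [])
    ∷ []

  slotCodes : Vec (Vec ℕ 42) 42
  slotCodes =
    (0 ∷ 145 ∷ 607 ∷ 147 ∷ 82 ∷ 763 ∷ 494 ∷ 732 ∷ 146 ∷ 61 ∷ 332 ∷ 198 ∷ 448 ∷ 526 ∷ 8 ∷ 794 ∷ 449 ∷ 696 ∷ 249 ∷ 834 ∷ 445 ∷ 0 ∷ 698 ∷ 132 ∷ 149 ∷ 699 ∷ 489 ∷ 379 ∷ 148 ∷ 650 ∷ 397 ∷ 447 ∷ 567 ∷ 216 ∷ 84 ∷ 697 ∷ 314 ∷ 80 ∷ 446 ∷ 83 ∷ 695 ∷ 81 ∷ [])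
    ∷ (145 ∷ 0 ∷ 29 ∷ 648 ∷ 742 ∷ 647 ∷ 722 ∷ 349 ∷ 382 ∷ 431 ∷ 721 ∷ 196 ∷ 513 ∷ 528 ∷ 720 ∷ 741 ∷ 744 ∷ 809 ∷ 345 ∷ 646 ∷ 560 ∷ 803 ∷ 0 ∷ 39 ∷ 88 ∷ 280 ∷ 488 ∷ 645 ∷ 724 ∷ 671 ∷ 399 ∷ 723 ∷ 740 ∷ 346 ∷ 743 ∷ 111 ∷ 347 ∷ 220 ∷ 263 ∷ 604 ∷ 348 ∷ 649 ∷ [])
    ∷ (607 ∷ 29 ∷ 0 ∷ 605 ∷ 387 ∷ 288 ∷ 608 ∷ 115 ∷ 255 ∷ 175 ∷ 772 ∷ 463 ∷ 324 ∷ 256 ∷ 257 ∷ 259 ∷ 609 ∷ 366 ∷ 495 ∷ 832 ∷ 258 ∷ 27 ∷ 144 ∷ 0 ∷ 230 ∷ 59 ∷ 656 ∷ 745 ∷ 589 ∷ 674 ∷ 539 ∷ 25 ∷ 90 ∷ 28 ∷ 141 ∷ 26 ∷ 606 ∷ 140 ∷ 700 ∷ 143 ∷ 441 ∷ 142 ∷ [])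
    ∷ (147 ∷ 648 ∷ 605 ∷ 0 ∷ 426 ∷ 591 ∷ 336 ∷ 481 ∷ 298 ∷ 735 ∷ 295 ∷ 338 ∷ 192 ∷ 527 ∷ 517 ∷ 793 ∷ 95 ∷ 194 ∷ 736 ∷ 339 ∷ 712 ∷ 44 ∷ 193 ∷ 335 ∷ 0 ∷ 337 ∷ 392 ∷ 375 ∷ 836 ∷ 739 ∷ 296 ∷ 124 ∷ 299 ∷ 738 ∷ 32 ∷ 297 ∷ 686 ∷ 737 ∷ 260 ∷ 190 ∷ 191 ∷ 236 ∷ [])
    ∷ (82 ∷ 742 ∷ 387 ∷ 426 ∷ 0 ∷ 475 ∷ 644 ∷ 118 ∷ 429 ∷ 178 ∷ 15 ∷ 610 ∷ 320 ∷ 388 ∷ 427 ∷ 810 ∷ 160 ∷ 369 ∷ 579 ∷ 578 ∷ 711 ∷ 804 ∷ 385 ∷ 164 ∷ 232 ∷ 0 ∷ 162 ∷ 386 ∷ 389 ∷ 275 ∷ 425 ∷ 666 ∷ 509 ∷ 577 ∷ 576 ∷ 163 ∷ 161 ∷ 428 ∷ 303 ∷ 575 ∷ 557 ∷ 66 ∷ [])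
    ∷ (763 ∷ 647 ∷ 288 ∷ 591 ∷ 475 ∷ 0 ∷ 477 ∷ 730 ∷ 383 ∷ 476 ∷ 16 ∷ 592 ∷ 590 ∷ 139 ∷ 286 ∷ 416 ∷ 98 ∷ 808 ∷ 437 ∷ 760 ∷ 343 ∷ 594 ∷ 593 ∷ 761 ∷ 287 ∷ 57 ∷ 0 ∷ 208 ∷ 764 ∷ 786 ∷ 762 ∷ 269 ∷ 508 ∷ 690 ∷ 479 ∷ 623 ∷ 478 ∷ 289 ∷ 157 ∷ 285 ∷ 555 ∷ 237 ∷ [])
    ∷ (494 ∷ 722 ∷ 608 ∷ 336 ∷ 644 ∷ 477 ∷ 0 ∷ 116 ∷ 684 ∷ 177 ∷ 271 ∷ 101 ∷ 272 ∷ 100 ∷ 154 ∷ 813 ∷ 1 ∷ 102 ∷ 436 ∷ 549 ∷ 643 ∷ 274 ∷ 750 ∷ 640 ∷ 270 ∷ 281 ∷ 103 ∷ 0 ∷ 585 ∷ 490 ∷ 398 ∷ 642 ∷ 641 ∷ 273 ∷ 783 ∷ 491 ∷ 493 ∷ 221 ∷ 492 ∷ 353 ∷ 104 ∷ 65 ∷ [])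
    ∷ (732 ∷ 349 ∷ 115 ∷ 481 ∷ 118 ∷ 730 ∷ 116 ∷ 0 ∷ 180 ∷ 432 ∷ 182 ∷ 117 ∷ 798 ∷ 529 ∷ 767 ∷ 181 ∷ 96 ∷ 367 ∷ 23 ∷ 483 ∷ 561 ∷ 43 ∷ 829 ∷ 484 ∷ 731 ∷ 284 ∷ 659 ∷ 480 ∷ 0 ∷ 733 ∷ 167 ∷ 184 ∷ 734 ∷ 524 ∷ 414 ∷ 183 ∷ 685 ∷ 222 ∷ 482 ∷ 602 ∷ 251 ∷ 119 ∷ [])
    ∷ (146 ∷ 382 ∷ 255 ∷ 298 ∷ 429 ∷ 383 ∷ 684 ∷ 180 ∷ 0 ∷ 64 ∷ 683 ∷ 777 ∷ 682 ∷ 757 ∷ 384 ∷ 417 ∷ 466 ∷ 756 ∷ 21 ∷ 548 ∷ 563 ∷ 755 ∷ 776 ∷ 779 ∷ 634 ∷ 380 ∷ 681 ∷ 595 ∷ 838 ∷ 0 ∷ 74 ∷ 123 ∷ 315 ∷ 523 ∷ 680 ∷ 759 ∷ 706 ∷ 224 ∷ 758 ∷ 775 ∷ 381 ∷ 778 ∷ [])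
    ∷ (61 ∷ 431 ∷ 175 ∷ 735 ∷ 178 ∷ 476 ∷ 177 ∷ 432 ∷ 64 ∷ 0 ∷ 430 ∷ 212 ∷ 323 ∷ 433 ∷ 150 ∷ 290 ∷ 0 ∷ 807 ∷ 498 ∷ 359 ∷ 291 ∷ 292 ∷ 294 ∷ 434 ∷ 401 ∷ 530 ∷ 657 ∷ 293 ∷ 62 ∷ 179 ∷ 0 ∷ 265 ∷ 94 ∷ 691 ∷ 780 ∷ 624 ∷ 709 ∷ 574 ∷ 60 ∷ 125 ∷ 63 ∷ 176 ∷ [])
    ∷ (332 ∷ 721 ∷ 772 ∷ 295 ∷ 15 ∷ 16 ∷ 271 ∷ 182 ∷ 683 ∷ 430 ∷ 0 ∷ 461 ∷ 626 ∷ 371 ∷ 516 ∷ 333 ∷ 770 ∷ 330 ∷ 373 ∷ 17 ∷ 562 ∷ 552 ∷ 828 ∷ 130 ∷ 19 ∷ 771 ∷ 374 ∷ 747 ∷ 79 ∷ 18 ∷ 370 ∷ 0 ∷ 372 ∷ 217 ∷ 410 ∷ 661 ∷ 774 ∷ 331 ∷ 159 ∷ 334 ∷ 773 ∷ 67 ∷ [])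
    ∷ (198 ∷ 196 ∷ 463 ∷ 338 ∷ 610 ∷ 592 ∷ 101 ∷ 117 ∷ 777 ∷ 212 ∷ 461 ∷ 0 ∷ 510 ∷ 679 ∷ 153 ∷ 464 ∷ 3 ∷ 50 ∷ 435 ∷ 355 ∷ 213 ∷ 462 ∷ 635 ∷ 195 ∷ 404 ∷ 614 ∷ 613 ∷ 746 ∷ 839 ∷ 210 ∷ 199 ∷ 267 ∷ 0 ∷ 197 ∷ 211 ∷ 214 ∷ 310 ∷ 460 ∷ 701 ∷ 544 ∷ 612 ∷ 611 ∷ [])
    ∷ (448 ∷ 513 ∷ 324 ∷ 192 ∷ 320 ∷ 590 ∷ 272 ∷ 798 ∷ 682 ∷ 323 ∷ 626 ∷ 510 ∷ 0 ∷ 512 ∷ 765 ∷ 418 ∷ 511 ∷ 51 ∷ 627 ∷ 625 ∷ 174 ∷ 321 ∷ 241 ∷ 133 ∷ 633 ∷ 472 ∷ 795 ∷ 378 ∷ 629 ∷ 628 ∷ 796 ∷ 322 ∷ 92 ∷ 0 ∷ 33 ∷ 799 ∷ 821 ∷ 797 ∷ 304 ∷ 543 ∷ 725 ∷ 514 ∷ [])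
    ∷ (526 ∷ 528 ∷ 256 ∷ 527 ∷ 388 ∷ 139 ∷ 100 ∷ 529 ∷ 757 ∷ 433 ∷ 371 ∷ 679 ∷ 512 ∷ 0 ∷ 151 ∷ 719 ∷ 2 ∷ 306 ∷ 136 ∷ 307 ∷ 135 ∷ 189 ∷ 638 ∷ 36 ∷ 137 ∷ 471 ∷ 584 ∷ 678 ∷ 309 ∷ 785 ∷ 675 ∷ 305 ∷ 316 ∷ 138 ∷ 0 ∷ 620 ∷ 525 ∷ 223 ∷ 677 ∷ 676 ∷ 308 ∷ 818 ∷ [])
    ∷ (8 ∷ 720 ∷ 257 ∷ 517 ∷ 427 ∷ 286 ∷ 154 ∷ 767 ∷ 384 ∷ 150 ∷ 516 ∷ 153 ∷ 765 ∷ 151 ∷ 0 ∷ 5 ∷ 467 ∷ 7 ∷ 152 ∷ 833 ∷ 564 ∷ 802 ∷ 6 ∷ 131 ∷ 402 ∷ 58 ∷ 518 ∷ 596 ∷ 78 ∷ 654 ∷ 519 ∷ 766 ∷ 319 ∷ 694 ∷ 515 ∷ 0 ∷ 768 ∷ 202 ∷ 9 ∷ 769 ∷ 559 ∷ 239 ∷ [])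
    ∷ (794 ∷ 741 ∷ 259 ∷ 793 ∷ 810 ∷ 416 ∷ 813 ∷ 181 ∷ 417 ∷ 290 ∷ 333 ∷ 464 ∷ 418 ∷ 719 ∷ 5 ∷ 0 ∷ 99 ∷ 718 ∷ 812 ∷ 717 ∷ 792 ∷ 419 ∷ 242 ∷ 501 ∷ 791 ∷ 56 ∷ 583 ∷ 598 ∷ 790 ∷ 811 ∷ 814 ∷ 669 ∷ 415 ∷ 716 ∷ 420 ∷ 663 ∷ 0 ∷ 109 ∷ 158 ∷ 350 ∷ 558 ∷ 715 ∷ [])
    ∷ (449 ∷ 744 ∷ 609 ∷ 95 ∷ 160 ∷ 98 ∷ 1 ∷ 96 ∷ 466 ∷ 0 ∷ 770 ∷ 3 ∷ 511 ∷ 2 ∷ 467 ∷ 99 ∷ 0 ∷ 465 ∷ 247 ∷ 358 ∷ 468 ∷ 185 ∷ 325 ∷ 35 ∷ 632 ∷ 533 ∷ 394 ∷ 326 ∷ 327 ∷ 329 ∷ 469 ∷ 226 ∷ 565 ∷ 692 ∷ 328 ∷ 97 ∷ 4 ∷ 0 ∷ 300 ∷ 129 ∷ 726 ∷ 815 ∷ [])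
    ∷ (696 ∷ 809 ∷ 366 ∷ 194 ∷ 369 ∷ 808 ∷ 102 ∷ 367 ∷ 756 ∷ 807 ∷ 330 ∷ 50 ∷ 51 ∷ 306 ∷ 7 ∷ 718 ∷ 465 ∷ 0 ∷ 496 ∷ 451 ∷ 406 ∷ 551 ∷ 368 ∷ 805 ∷ 365 ∷ 408 ∷ 52 ∷ 597 ∷ 587 ∷ 653 ∷ 165 ∷ 54 ∷ 806 ∷ 409 ∷ 782 ∷ 114 ∷ 53 ∷ 405 ∷ 0 ∷ 407 ∷ 252 ∷ 235 ∷ [])
    ∷ (249 ∷ 345 ∷ 495 ∷ 736 ∷ 579 ∷ 437 ∷ 436 ∷ 23 ∷ 21 ∷ 498 ∷ 373 ∷ 435 ∷ 627 ∷ 136 ∷ 152 ∷ 812 ∷ 247 ∷ 496 ∷ 0 ∷ 545 ∷ 714 ∷ 188 ∷ 499 ∷ 38 ∷ 85 ∷ 470 ∷ 390 ∷ 248 ∷ 497 ∷ 670 ∷ 20 ∷ 229 ∷ 439 ∷ 438 ∷ 781 ∷ 664 ∷ 245 ∷ 24 ∷ 302 ∷ 0 ∷ 22 ∷ 246 ∷ [])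
    ∷ (834 ∷ 646 ∷ 832 ∷ 339 ∷ 578 ∷ 760 ∷ 549 ∷ 483 ∷ 548 ∷ 359 ∷ 17 ∷ 355 ∷ 625 ∷ 307 ∷ 833 ∷ 717 ∷ 358 ∷ 451 ∷ 545 ∷ 0 ∷ 547 ∷ 800 ∷ 243 ∷ 546 ∷ 86 ∷ 452 ∷ 450 ∷ 209 ∷ 356 ∷ 276 ∷ 168 ∷ 668 ∷ 507 ∷ 830 ∷ 413 ∷ 454 ∷ 453 ∷ 831 ∷ 357 ∷ 127 ∷ 0 ∷ 68 ∷ [])
    ∷ (445 ∷ 560 ∷ 258 ∷ 712 ∷ 711 ∷ 343 ∷ 643 ∷ 561 ∷ 563 ∷ 291 ∷ 562 ∷ 213 ∷ 174 ∷ 135 ∷ 564 ∷ 792 ∷ 468 ∷ 406 ∷ 714 ∷ 547 ∷ 0 ∷ 186 ∷ 754 ∷ 37 ∷ 341 ∷ 171 ∷ 342 ∷ 170 ∷ 14 ∷ 673 ∷ 71 ∷ 172 ∷ 506 ∷ 619 ∷ 713 ∷ 344 ∷ 820 ∷ 710 ∷ 340 ∷ 351 ∷ 173 ∷ 0 ∷ [])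
    ∷ (0 ∷ 803 ∷ 27 ∷ 44 ∷ 804 ∷ 594 ∷ 274 ∷ 43 ∷ 755 ∷ 292 ∷ 552 ∷ 462 ∷ 321 ∷ 189 ∷ 802 ∷ 419 ∷ 185 ∷ 551 ∷ 188 ∷ 800 ∷ 186 ∷ 0 ∷ 40 ∷ 502 ∷ 42 ∷ 187 ∷ 658 ∷ 599 ∷ 837 ∷ 41 ∷ 166 ∷ 227 ∷ 93 ∷ 553 ∷ 421 ∷ 113 ∷ 689 ∷ 554 ∷ 801 ∷ 354 ∷ 729 ∷ 550 ∷ [])
    ∷ (698 ∷ 0 ∷ 144 ∷ 193 ∷ 385 ∷ 593 ∷ 750 ∷ 829 ∷ 776 ∷ 294 ∷ 828 ∷ 635 ∷ 241 ∷ 638 ∷ 6 ∷ 242 ∷ 325 ∷ 368 ∷ 499 ∷ 243 ∷ 754 ∷ 40 ∷ 0 ∷ 134 ∷ 753 ∷ 637 ∷ 752 ∷ 827 ∷ 244 ∷ 277 ∷ 536 ∷ 826 ∷ 91 ∷ 618 ∷ 423 ∷ 825 ∷ 636 ∷ 639 ∷ 704 ∷ 240 ∷ 751 ∷ 455 ∷ [])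
    ∷ (132 ∷ 39 ∷ 0 ∷ 335 ∷ 164 ∷ 761 ∷ 640 ∷ 484 ∷ 779 ∷ 434 ∷ 130 ∷ 195 ∷ 133 ∷ 36 ∷ 131 ∷ 501 ∷ 35 ∷ 805 ∷ 38 ∷ 546 ∷ 37 ∷ 502 ∷ 134 ∷ 0 ∷ 500 ∷ 282 ∷ 393 ∷ 503 ∷ 10 ∷ 360 ∷ 70 ∷ 667 ∷ 568 ∷ 219 ∷ 361 ∷ 362 ∷ 364 ∷ 504 ∷ 261 ∷ 600 ∷ 727 ∷ 363 ∷ [])
    ∷ (149 ∷ 88 ∷ 230 ∷ 0 ∷ 232 ∷ 287 ∷ 270 ∷ 731 ∷ 634 ∷ 401 ∷ 19 ∷ 404 ∷ 633 ∷ 137 ∷ 402 ∷ 791 ∷ 632 ∷ 365 ∷ 85 ∷ 86 ∷ 341 ∷ 42 ∷ 753 ∷ 500 ∷ 0 ∷ 531 ∷ 486 ∷ 231 ∷ 586 ∷ 403 ∷ 630 ∷ 400 ∷ 233 ∷ 87 ∷ 422 ∷ 622 ∷ 688 ∷ 200 ∷ 89 ∷ 631 ∷ 234 ∷ 817 ∷ [])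
    ∷ (699 ∷ 280 ∷ 59 ∷ 337 ∷ 0 ∷ 57 ∷ 281 ∷ 284 ∷ 380 ∷ 530 ∷ 771 ∷ 614 ∷ 472 ∷ 471 ∷ 58 ∷ 56 ∷ 533 ∷ 408 ∷ 470 ∷ 452 ∷ 171 ∷ 187 ∷ 637 ∷ 282 ∷ 531 ∷ 0 ∷ 580 ∷ 749 ∷ 13 ∷ 534 ∷ 73 ∷ 120 ∷ 505 ∷ 215 ∷ 283 ∷ 532 ∷ 705 ∷ 55 ∷ 264 ∷ 474 ∷ 473 ∷ 816 ∷ [])
    ∷ (489 ∷ 488 ∷ 656 ∷ 392 ∷ 162 ∷ 0 ∷ 103 ∷ 659 ∷ 681 ∷ 657 ∷ 374 ∷ 613 ∷ 795 ∷ 584 ∷ 518 ∷ 583 ∷ 394 ∷ 52 ∷ 390 ∷ 450 ∷ 342 ∷ 658 ∷ 752 ∷ 393 ∷ 486 ∷ 580 ∷ 0 ∷ 582 ∷ 835 ∷ 278 ∷ 581 ∷ 121 ∷ 487 ∷ 485 ∷ 34 ∷ 391 ∷ 311 ∷ 203 ∷ 703 ∷ 542 ∷ 655 ∷ 238 ∷ [])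
    ∷ (379 ∷ 645 ∷ 745 ∷ 375 ∷ 386 ∷ 208 ∷ 0 ∷ 480 ∷ 595 ∷ 293 ∷ 747 ∷ 746 ∷ 378 ∷ 678 ∷ 596 ∷ 598 ∷ 326 ∷ 597 ∷ 248 ∷ 209 ∷ 170 ∷ 599 ∷ 827 ∷ 503 ∷ 231 ∷ 749 ∷ 582 ∷ 0 ∷ 11 ∷ 789 ∷ 72 ∷ 376 ∷ 206 ∷ 377 ∷ 205 ∷ 49 ∷ 708 ∷ 106 ∷ 207 ∷ 541 ∷ 444 ∷ 748 ∷ [])
    ∷ (148 ∷ 724 ∷ 589 ∷ 836 ∷ 389 ∷ 764 ∷ 585 ∷ 0 ∷ 838 ∷ 62 ∷ 79 ∷ 839 ∷ 629 ∷ 309 ∷ 78 ∷ 790 ∷ 327 ∷ 587 ∷ 497 ∷ 356 ∷ 14 ∷ 837 ∷ 244 ∷ 10 ∷ 586 ∷ 13 ∷ 835 ∷ 11 ∷ 0 ∷ 75 ∷ 537 ∷ 77 ∷ 12 ∷ 693 ∷ 424 ∷ 662 ∷ 76 ∷ 201 ∷ 262 ∷ 128 ∷ 588 ∷ 456 ∷ [])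
    ∷ (650 ∷ 671 ∷ 674 ∷ 739 ∷ 275 ∷ 786 ∷ 490 ∷ 733 ∷ 0 ∷ 179 ∷ 18 ∷ 210 ∷ 628 ∷ 785 ∷ 654 ∷ 811 ∷ 329 ∷ 653 ∷ 670 ∷ 276 ∷ 673 ∷ 41 ∷ 277 ∷ 360 ∷ 403 ∷ 534 ∷ 278 ∷ 789 ∷ 75 ∷ 0 ∷ 169 ∷ 788 ∷ 672 ∷ 787 ∷ 652 ∷ 279 ∷ 312 ∷ 571 ∷ 651 ∷ 126 ∷ 443 ∷ 458 ∷ [])
    ∷ (397 ∷ 399 ∷ 539 ∷ 296 ∷ 425 ∷ 762 ∷ 398 ∷ 167 ∷ 74 ∷ 0 ∷ 370 ∷ 199 ∷ 796 ∷ 675 ∷ 519 ∷ 814 ∷ 469 ∷ 165 ∷ 20 ∷ 168 ∷ 71 ∷ 166 ∷ 536 ∷ 70 ∷ 630 ∷ 73 ∷ 581 ∷ 72 ∷ 537 ∷ 169 ∷ 0 ∷ 535 ∷ 317 ∷ 218 ∷ 538 ∷ 45 ∷ 395 ∷ 105 ∷ 702 ∷ 603 ∷ 254 ∷ 396 ∷ [])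
    ∷ (447 ∷ 723 ∷ 25 ∷ 124 ∷ 666 ∷ 269 ∷ 642 ∷ 184 ∷ 123 ∷ 265 ∷ 0 ∷ 267 ∷ 322 ∷ 305 ∷ 766 ∷ 669 ∷ 226 ∷ 54 ∷ 229 ∷ 668 ∷ 172 ∷ 227 ∷ 826 ∷ 667 ∷ 400 ∷ 120 ∷ 121 ∷ 376 ∷ 77 ∷ 788 ∷ 535 ∷ 0 ∷ 566 ∷ 521 ∷ 266 ∷ 621 ∷ 228 ∷ 665 ∷ 225 ∷ 268 ∷ 122 ∷ 457 ∷ [])
    ∷ (567 ∷ 740 ∷ 90 ∷ 299 ∷ 509 ∷ 508 ∷ 641 ∷ 734 ∷ 315 ∷ 94 ∷ 372 ∷ 0 ∷ 92 ∷ 316 ∷ 319 ∷ 415 ∷ 565 ∷ 806 ∷ 439 ∷ 507 ∷ 506 ∷ 93 ∷ 91 ∷ 568 ∷ 233 ∷ 505 ∷ 487 ∷ 206 ∷ 12 ∷ 672 ∷ 317 ∷ 566 ∷ 0 ∷ 615 ∷ 784 ∷ 48 ∷ 569 ∷ 108 ∷ 155 ∷ 540 ∷ 250 ∷ 318 ∷ [])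
    ∷ (216 ∷ 346 ∷ 28 ∷ 738 ∷ 577 ∷ 690 ∷ 273 ∷ 524 ∷ 523 ∷ 691 ∷ 217 ∷ 197 ∷ 0 ∷ 138 ∷ 694 ∷ 716 ∷ 692 ∷ 409 ∷ 438 ∷ 830 ∷ 619 ∷ 553 ∷ 618 ∷ 219 ∷ 87 ∷ 215 ∷ 485 ∷ 377 ∷ 693 ∷ 787 ∷ 218 ∷ 521 ∷ 615 ∷ 0 ∷ 617 ∷ 660 ∷ 313 ∷ 616 ∷ 156 ∷ 522 ∷ 520 ∷ 69 ∷ [])
    ∷ (84 ∷ 743 ∷ 141 ∷ 32 ∷ 576 ∷ 479 ∷ 783 ∷ 414 ∷ 680 ∷ 780 ∷ 410 ∷ 211 ∷ 33 ∷ 0 ∷ 515 ∷ 420 ∷ 328 ∷ 782 ∷ 781 ∷ 413 ∷ 713 ∷ 421 ∷ 423 ∷ 361 ∷ 422 ∷ 283 ∷ 34 ∷ 205 ∷ 424 ∷ 652 ∷ 538 ∷ 266 ∷ 784 ∷ 617 ∷ 0 ∷ 46 ∷ 824 ∷ 107 ∷ 411 ∷ 31 ∷ 412 ∷ 30 ∷ [])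
    ∷ (697 ∷ 111 ∷ 26 ∷ 297 ∷ 163 ∷ 623 ∷ 491 ∷ 183 ∷ 759 ∷ 624 ∷ 661 ∷ 214 ∷ 799 ∷ 620 ∷ 0 ∷ 663 ∷ 97 ∷ 114 ∷ 664 ∷ 454 ∷ 344 ∷ 113 ∷ 825 ∷ 362 ∷ 622 ∷ 532 ∷ 391 ∷ 49 ∷ 662 ∷ 279 ∷ 45 ∷ 621 ∷ 48 ∷ 660 ∷ 46 ∷ 0 ∷ 110 ∷ 572 ∷ 112 ∷ 47 ∷ 728 ∷ 459 ∷ [])
    ∷ (314 ∷ 347 ∷ 606 ∷ 686 ∷ 161 ∷ 478 ∷ 493 ∷ 685 ∷ 706 ∷ 709 ∷ 774 ∷ 310 ∷ 821 ∷ 525 ∷ 768 ∷ 0 ∷ 4 ∷ 53 ∷ 245 ∷ 453 ∷ 820 ∷ 689 ∷ 636 ∷ 364 ∷ 688 ∷ 705 ∷ 311 ∷ 708 ∷ 76 ∷ 312 ∷ 395 ∷ 228 ∷ 569 ∷ 313 ∷ 824 ∷ 110 ∷ 0 ∷ 204 ∷ 823 ∷ 707 ∷ 822 ∷ 687 ∷ [])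
    ∷ (80 ∷ 220 ∷ 140 ∷ 737 ∷ 428 ∷ 289 ∷ 221 ∷ 222 ∷ 224 ∷ 574 ∷ 331 ∷ 460 ∷ 797 ∷ 223 ∷ 202 ∷ 109 ∷ 0 ∷ 405 ∷ 24 ∷ 831 ∷ 710 ∷ 554 ∷ 639 ∷ 504 ∷ 200 ∷ 55 ∷ 203 ∷ 106 ∷ 201 ∷ 571 ∷ 105 ∷ 665 ∷ 108 ∷ 616 ∷ 107 ∷ 572 ∷ 204 ∷ 0 ∷ 570 ∷ 352 ∷ 253 ∷ 573 ∷ [])
    ∷ (446 ∷ 263 ∷ 700 ∷ 260 ∷ 303 ∷ 157 ∷ 492 ∷ 482 ∷ 758 ∷ 60 ∷ 159 ∷ 701 ∷ 304 ∷ 677 ∷ 9 ∷ 158 ∷ 300 ∷ 0 ∷ 302 ∷ 357 ∷ 340 ∷ 801 ∷ 704 ∷ 261 ∷ 89 ∷ 264 ∷ 703 ∷ 207 ∷ 262 ∷ 651 ∷ 702 ∷ 225 ∷ 155 ∷ 156 ∷ 411 ∷ 112 ∷ 823 ∷ 570 ∷ 0 ∷ 601 ∷ 556 ∷ 301 ∷ [])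
    ∷ (83 ∷ 604 ∷ 143 ∷ 190 ∷ 575 ∷ 285 ∷ 353 ∷ 602 ∷ 775 ∷ 125 ∷ 334 ∷ 544 ∷ 543 ∷ 676 ∷ 769 ∷ 350 ∷ 129 ∷ 407 ∷ 0 ∷ 127 ∷ 351 ∷ 354 ∷ 240 ∷ 600 ∷ 631 ∷ 474 ∷ 542 ∷ 541 ∷ 128 ∷ 126 ∷ 603 ∷ 268 ∷ 540 ∷ 522 ∷ 31 ∷ 47 ∷ 707 ∷ 352 ∷ 601 ∷ 0 ∷ 440 ∷ 819 ∷ [])
    ∷ (695 ∷ 348 ∷ 441 ∷ 191 ∷ 557 ∷ 555 ∷ 104 ∷ 251 ∷ 381 ∷ 63 ∷ 773 ∷ 612 ∷ 725 ∷ 308 ∷ 559 ∷ 558 ∷ 726 ∷ 252 ∷ 22 ∷ 0 ∷ 173 ∷ 729 ∷ 751 ∷ 727 ∷ 234 ∷ 473 ∷ 655 ∷ 444 ∷ 588 ∷ 443 ∷ 254 ∷ 122 ∷ 250 ∷ 520 ∷ 412 ∷ 728 ∷ 822 ∷ 253 ∷ 556 ∷ 440 ∷ 0 ∷ 442 ∷ [])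
    ∷ (81 ∷ 649 ∷ 142 ∷ 236 ∷ 66 ∷ 237 ∷ 65 ∷ 119 ∷ 778 ∷ 176 ∷ 67 ∷ 611 ∷ 514 ∷ 818 ∷ 239 ∷ 715 ∷ 815 ∷ 235 ∷ 246 ∷ 68 ∷ 0 ∷ 550 ∷ 455 ∷ 363 ∷ 817 ∷ 816 ∷ 238 ∷ 748 ∷ 456 ∷ 458 ∷ 396 ∷ 457 ∷ 318 ∷ 69 ∷ 30 ∷ 459 ∷ 687 ∷ 573 ∷ 301 ∷ 819 ∷ 442 ∷ 0 ∷ [])
    ∷ []

  vertexAt : Fin 24 → Fin 7 × Fin 6 → Fin 42
  vertexAt f (i , j) =
    let b , r = remQuot {4} 6 f
    in  (lookup (lookup (lookup baseFactors b) i) j + 7 * toℕ r) mod 42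

  positionOf : Fin 24 → Fin 42 → Fin 7 × Fin 6
  positionOf f x =
    let b , r = remQuot {4} 6 f
        c     = lookup (lookup basePositions b) ((toℕ x + 7 * (6 ∸ toℕ r)) mod 42)
    in  (c / 6) mod 7 , c mod 6

  vertexAt-positionOf : ∀ f x → vertexAt f (positionOf f x) ≡ x
  vertexAt-positionOf = toWitness {a? = all? λ f → all? λ x → vertexAt f (positionOf f x) ≟ x} tt

  positionOf-vertexAt : ∀ f i j → positionOf f (vertexAt f (i , j)) ≡ (i , j)
  positionOf-vertexAt = toWitness
    {a? = all? λ f → all? λ i → all? λ j → ≡-dec _≟_ _≟_ (positionOf f (vertexAt f (i , j))) (i , j)} tt

  layout : Fin 24 → (Fin 7 × Fin 6) ↔ Fin 42
  layout f = mk↔ₛ′ (vertexAt f) (positionOf f) (vertexAt-positionOf f)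
                   (λ (i , j) → positionOf-vertexAt f i j)

  slotOf : Fin 42 → Fin 42 → Slot 24 7 5
  slotOf u v =
    let c = lookup (lookup slotCodes u) v
    in  (c / 35) mod 24 , (c / 5) mod 7 , c mod 5

  H : Graph 42
  H = KminusPM 42 (standardMatching 21)

  adj? : ∀ u v → Dec (Adj H u v)
  adj? u v = ¬? (u ≟ v) ×-dec ¬? (standardPartner 21 u ≟ v)

  slot-adj : ∀ f i j → Adj H (centre layout (f , i , j)) (leaf layout (f , i , j))
  slot-adj = toWitness
    {a? = all? λ f → all? λ i → all? λ j → adj? (centre layout (f , i , j)) (leaf layout (f , i , j))} tt

  slotOf-centreLeaf : ∀ f i j → slotOf (centre layout (f , i , j)) (leaf layout (f , i , j)) ≡ (f , i , j)
  slotOf-centreLeaf = toWitness {a? = all? λ f → all? λ i → all? λ j →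
    slotOf (centre layout (f , i , j)) (leaf layout (f , i , j)) ≟-slot (f , i , j)} tt

  slotOf-leafCentre : ∀ f i j → slotOf (leaf layout (f , i , j)) (centre layout (f , i , j)) ≡ (f , i , j)
  slotOf-leafCentre = toWitness {a? = all? λ f → all? λ i → all? λ j →
    slotOf (leaf layout (f , i , j)) (centre layout (f , i , j)) ≟-slot (f , i , j)} tt

  slotOf-joins : ∀ u v → Adj H u v → Joins layout (slotOf u v) u v
  slotOf-joins = toWitness {a? = all? λ u → all? λ v → adj? u v →-dec joins? layout (slotOf u v) u v} tt

  table : StarFactorTable 5 H
  table = record
    { factors           = 24
    ; stars             = 7
    ; layout            = layout
    ; slot-adj          = λ (f , i , j) → slot-adj f i j
    ; slotOf            = slotOf
    ; slotOf-centreLeaf = λ (f , i , j) → slotOf-centreLeaf f i j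
    ; slotOf-leafCentre = λ (f , i , j) → slotOf-leafCentre f i j
    ; slotOf-joins      = slotOf-joins _ _
    }

lemma6p1 : (I : PerfectMatching 42) → StarFactorDecomposition 5 (KminusPM 42 I)
lemma6p1 I =
  let σ , conjugates =
        Conjugation.conjugator {21} (partner I) (partner-involutive I) (partner-fixedPointFree I)
  in  transportDecomposition (complement-≅ (standardMatching 21) I σ conjugates)
                             (StarFactorTable.decomposition K₄₂.table)
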